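{- Let $H=(V,E)$ be an unweighted hypergraph on $n$ vertices and $c>0$. Suppose $\textsc{WeakEdges}(H',k)$ is a procedure that, given a hypergraph $H'$ and a number $k$, returns a subset of the edges of $H'$ containing every edge $e$ of $H'$ with $\gamma_{H'}(e)<k$, and that for every $k$ its output is $ck$-light in $H'$. Run the algorithm $\textsc{Estimation}(H)$: choose $k$ with $\gamma_H(e)\ge k$ for all $e\in E$; set $H_0=H$, $i=1$; while $H_{i-1}$ has edges, let $F_i=\textsc{WeakEdges}(H_{i-1},2^ik)$, set $\gamma'(e)=2^{i-1}k$ for every $e\in F_i$, set $H_i=H_{i-1}-F_i$, and increase $i$ by $1$. Then the output satisfies $\sum_{e\in E}\frac{1}{\gamma'(e)}\le 2c(n-1)$.
   Context: A hypergraph $H=(V,E)$ has finite vertex set $V$ and a (multi)set $E$ of edges, each a nonempty subset of $V$. For $U\subseteq V$, $H[U]=(U,\{e\in E:e\subseteq U\})$. For $A\subseteq V$, $\delta_H(A)=\{e\in E: e\cap A\ne\emptyset,\ e\cap (V\setminus A)\ne\emptyset\}$. $\lambda(H)=\min_{\emptyset\subsetneq A\subsetneq V}|\delta_H(A)|$ and the strength of $e$ is $\gamma_H(e)=\max_{e\subseteq U\subseteq V}\lambda(H[U])$. $\kappa(H)$ denotes the number of connected components of $H$. A set of edges $E'\subseteq E$ is $\ell$-light (in $H$) if $|E'|\le \ell\,(\kappa(H-E')-\kappa(H))$, where $H-E'$ is $H$ with the edges of $E'$ deleted.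
   Formalization: The constants c and k, the numbers given to WeakEdges and the values γ' are all taken to be rational. -}

module Defs where

open import Data.Nat as ℕ using (ℕ; zero; suc; _^_; _∸_)
open import Data.Integer using (+_)
open import Data.Bool using (Bool; _∧_)
open import Data.Fin using (Fin)
open import Data.Fin.Subset using (Subset; _∈_; _⊆_; _∩_; _─_; Nonempty; Empty; ∣_∣; ⊤)
open import Data.Fin.Subset.Properties using (_⊆?_; nonempty?)
open import Data.Vec using (tabulate; lookup)
open import Data.Product using (Σ; ∃; _×_)
open import Data.Rational using (ℚ; _/_; _*_; _+_; _-_; _≤_; 0ℚ; 1/_; ≢-nonZero)
open import Data.Rational.Properties using (_≟_)
open import Relation.Nullary using (¬_; yes; no)
open import Relation.Nullary.Decidable using (⌊_⌋)
open import Relation.Binary.PropositionalEquality using (_≡_)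
open import Relation.Binary.Construct.Closure.ReflexiveTransitive using (Star)
open import Function.Definitions using (Surjective)

ofℕ : ℕ → ℚ
ofℕ n = + n / 1

-- 1/q (total: we set inv 0 = 0; only ever applied to positive values)
inv : ℚ → ℚ
inv q with q ≟ 0ℚ
... | yes _ = 0ℚ
... | no q≢0 = 1/_ q {{≢-nonZero q≢0}}

sumFin : (m : ℕ) → (Fin m → ℚ) → ℚ
sumFin zero    f = 0ℚ
sumFin (suc m) f = f Fin.zero + sumFin m (λ j → f (Fin.suc j))

-- A hypergraph on vertex set Fin n with an (indexed multi)set of m edges
-- is given by  E : Fin m → Subset n.  A sub-hypergraph  H - F  obtained by
-- deleting edges is represented by the set  S : Subset m  of edges still
-- present (all vertices are kept).

Edges : ℕ → ℕ → Set
Edges n m = Fin m → Subset n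

module _ {n m : ℕ} (E : Edges n m) where

  inducedEdges : Subset m → Subset n → Subset m
  inducedEdges S U = tabulate λ j → lookup S j ∧ ⌊ E j ⊆? U ⌋

  cut : Subset m → Subset n → Subset n → Subset m
  cut S U A = tabulate λ j →
    lookup (inducedEdges S U) j ∧ (⌊ nonempty? (E j ∩ A) ⌋ ∧ ⌊ nonempty? (E j ∩ (U ─ A)) ⌋)

  -- λ((V,S)[U]) ≥ k, where λ is the minimum of |δ(A)| over ∅ ≠ A ⊊ U
  -- (min over the empty family = ∞)
  EdgeConnAtLeast : Subset m → Subset n → ℚ → Set
  EdgeConnAtLeast S U k =
    ∀ (A : Subset n) → A ⊆ U → Nonempty A → Nonempty (U ─ A) → k ≤ ofℕ ∣ cut S U A ∣

  -- γ_{(V,S)}(e_j) ≥ k, where γ(e) = max_{e ⊆ U ⊆ V} λ(H[U])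
  StrengthAtLeast : Subset m → Fin m → ℚ → Set
  StrengthAtLeast S j k = ∃ λ (U : Subset n) → E j ⊆ U × EdgeConnAtLeast S U k

  StrengthLess : Subset m → Fin m → ℚ → Set
  StrengthLess S j k = ¬ StrengthAtLeast S j k

  Adjacent : Subset m → Fin n → Fin n → Set
  Adjacent S u v = ∃ λ j → j ∈ S × u ∈ E j × v ∈ E j

  Connected : Subset m → Fin n → Fin n → Set
  Connected S = Star (Adjacent S)

  HasComponents : Subset m → ℕ → Set
  HasComponents S c = Σ (Fin n → Fin c) λ f →
    Surjective _≡_ _≡_ f ×
    (∀ u v → (f u ≡ f v → Connected S u v) × (Connected S u v → f u ≡ f v))

  Light : Subset m → Subset m → ℚ → Set
  Light S F ℓ = ∀ c₁ c₂ → HasComponents S c₁ → HasComponents (S ─ F) c₂ →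
    ofℕ ∣ F ∣ ≤ ℓ * (ofℕ c₂ - ofℕ c₁)

  WeakEdgesSpec : ℚ → (Subset m → ℚ → Subset m) → Set
  WeakEdgesSpec c W = ∀ (S : Subset m) (k : ℚ) →
    (W S k ⊆ S) ×
    (∀ j → j ∈ S → StrengthLess S j k → j ∈ W S k) ×
    Light S (W S k) (c * k)

  -- EstimationFrom W k i S g : the while-loop of Estimation, entered with
  -- counter i and current hypergraph H_{i-1} = (V,S), terminates, and the
  -- values γ'(e) it assigns to the edges e ∈ S are g e.
  data EstimationFrom (W : Subset m → ℚ → Subset m) (k : ℚ) :
         ℕ → Subset m → (Fin m → ℚ) → Set where
    stop : ∀ {i S g} → Empty S → EstimationFrom W k i S g
    step : ∀ {i S g} → Nonempty S →
           (∀ j → j ∈ S → j ∈ W S (ofℕ (2 ^ i) * k) →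
                  g j ≡ ofℕ (2 ^ (i ∸ 1)) * k) →
           EstimationFrom W k (suc i) (S ─ W S (ofℕ (2 ^ i) * k)) g →
           EstimationFrom W k i S g

  Estimation : (Subset m → ℚ → Subset m) → ℚ → (Fin m → ℚ) → Set
  Estimation W k γ' = EstimationFrom W k 1 ⊤ γ'

module Submission where

-- The proof is a charging argument along the run of the algorithm.  Give the
-- current hypergraph (V,S), which has κ(S) components, the budget
-- 2c(n - κ(S)).  In round i the removed set F = WeakEdges(S, 2^i k) is
-- (c 2^i k)-light, i.e. |F| ≤ c 2^i k (κ(S - F) - κ(S)), and each of its
-- edges gets γ' = 2^(i-1) k; so these edges cost |F| / (2^(i-1) k), which is
-- at most 2c (κ(S - F) - κ(S)), exactly the drop of the budget from S to
-- S - F.  By induction along the run, the cost of S is within its budget, and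
-- at the start κ(H) ≥ 1 because V is nonempty.

open import Defs
open import Data.Nat using (ℕ; _≥_; _∸_)
open import Data.Fin using (Fin)
open import Data.Fin.Subset using (Subset; Nonempty; ⊤)
open import Data.Rational using (ℚ; _<_; _≤_; _*_; 0ℚ)

open import Level using (0ℓ)
open import Function using (_∘_)
open import Function.Definitions using (Surjective)
open import Data.Nat as ℕ using (zero; suc; z≤n; s≤s; _^_)
import Data.Nat.Properties as ℕ
open import Data.Nat.Coprimality as Coprime using ()
open import Data.Integer as ℤ using (+_)
import Data.Integer.Properties as ℤ
open import Data.Rational using (mkℚ; _+_; _-_; 1ℚ; *≤*; nonNegative; positive; ≢-nonZero)
open import Data.Rational.Properties
open import Data.Rational.Solver using (module +-*-Solver)
open import Algebra.Bundles using (CommutativeMonoid)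
open import Algebra.Properties.CommutativeSemigroup
  (CommutativeMonoid.commutativeSemigroup +-0-commutativeMonoid) using (x∙yz≈y∙xz)
open import Data.Fin using (zero; suc)
open import Data.Fin.Properties using (any?; injective⇒≤; suc-injective) renaming (_≟_ to _≟ᶠ_)
open import Data.Fin.Subset using (_∈_; _⊆_; _─_; Empty; ∣_∣; inside; outside)
open import Data.Fin.Subset.Properties using (_∈?_; drop-∷-⊆; drop-∷-Empty)
open import Data.Vec using ([]; _∷_; here; there)
open import Data.Vec.Functional as Vector using (head; tail)
open import Data.Product using (Σ; ∃; _×_; _,_; proj₁; proj₂)
open import Data.Sum using (_⊎_; inj₁; inj₂)
open import Data.Empty using (⊥-elim)
open import Relation.Nullary using (¬_; Dec; yes; no)
open import Relation.Nullary.Decidable using (map′; _×-dec_; _⊎-dec_)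
open import Relation.Binary using (Rel; Decidable; IsEquivalence; IsDecEquivalence)
open import Relation.Binary.PropositionalEquality
  using (_≡_; refl; sym; trans; cong; cong₂; subst; module ≡-Reasoning)
open import Relation.Binary.Construct.Closure.ReflexiveTransitive
  using (ε; _◅_; _◅◅_; gmap; reverse)

ofℕ-canonical : ∀ k → ofℕ k ≡ mkℚ (+ k) 0 (Coprime.sym (Coprime.1-coprimeTo k))
ofℕ-canonical k = normalize-coprime (Coprime.sym (Coprime.1-coprimeTo k))

ofℕ-+ : ∀ a b → ofℕ (a ℕ.+ b) ≡ ofℕ a + ofℕ b
ofℕ-+ a b = begin
  ofℕ (a ℕ.+ b)                       ≡⟨ /-cong numerator refl ⟩
  (+ a ℤ.* + 1 ℤ.+ + b ℤ.* + 1) / 1   ≡⟨ cong₂ _+_ (ofℕ-canonical a) (ofℕ-canonical b) ⟨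
  ofℕ a + ofℕ b                       ∎
  where
  open ≡-Reasoning
  open Data.Rational using (_/_)
  numerator : + (a ℕ.+ b) ≡ + a ℤ.* + 1 ℤ.+ + b ℤ.* + 1
  numerator = trans (ℤ.pos-+ a b)
    (sym (cong₂ ℤ._+_ (ℤ.*-identityʳ (+ a)) (ℤ.*-identityʳ (+ b))))

ofℕ-* : ∀ a b → ofℕ (a ℕ.* b) ≡ ofℕ a * ofℕ b
ofℕ-* a b = begin
  ofℕ (a ℕ.* b)       ≡⟨ /-cong (ℤ.pos-* a b) refl ⟩
  (+ a ℤ.* + b) / 1   ≡⟨ cong₂ _*_ (ofℕ-canonical a) (ofℕ-canonical b) ⟨
  ofℕ a * ofℕ b       ∎
  where
  open ≡-Reasoning
  open Data.Rational using (_/_)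

ofℕ-mono-≤ : ∀ {a b} → a ℕ.≤ b → ofℕ a ≤ ofℕ b
ofℕ-mono-≤ {a} {b} a≤b rewrite ofℕ-canonical a | ofℕ-canonical b =
  *≤* (ℤ.*-monoʳ-≤-nonNeg (+ 1) (ℤ.+≤+ a≤b))

ofℕ-pos : ∀ k .{{_ : ℕ.NonZero k}} → 0ℚ < ofℕ k
ofℕ-pos k = positive⁻¹ (ofℕ k) {{normalize-pos k 1}}

ofℕ-∸ : ∀ {a b} → b ℕ.≤ a → ofℕ a - ofℕ b ≡ ofℕ (a ∸ b)
ofℕ-∸ {a} {b} b≤a = begin
  ofℕ a - ofℕ b                          ≡⟨ cong (λ x → ofℕ x - ofℕ b) (ℕ.m+[n∸m]≡n b≤a) ⟨
  ofℕ (b ℕ.+ (a ∸ b)) - ofℕ b            ≡⟨ cong (_- ofℕ b) (ofℕ-+ b (a ∸ b)) ⟩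
  (ofℕ b + ofℕ (a ∸ b)) - ofℕ b          ≡⟨ solve 2 (λ x y → (x :+ y) :- x := y) refl (ofℕ b) (ofℕ (a ∸ b)) ⟩
  ofℕ (a ∸ b)                            ∎
  where
  open ≡-Reasoning
  open +-*-Solver

scale-≤ : ∀ {t x y} → 0ℚ ≤ t → x ≤ y → t * x ≤ t * y
scale-≤ {t} 0≤t = *-monoˡ-≤-nonNeg t {{nonNegative 0≤t}}

inv-inverse : ∀ {q} → 0ℚ < q → q * inv q ≡ 1ℚ
inv-inverse {q} 0<q with q ≟ 0ℚ
... | yes refl = ⊥-elim (<-irrefl refl 0<q)
... | no q≢0   = *-inverseʳ q {{≢-nonZero q≢0}}

inv-nonneg : ∀ {q} → 0ℚ < q → 0ℚ ≤ inv q
inv-nonneg {q} 0<q with q ≟ 0ℚ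
... | yes refl = ⊥-elim (<-irrefl refl 0<q)
... | no q≢0   = <⇒≤ (positive⁻¹ _ {{1/pos⇒pos q {{positive 0<q}}}})

charge-≤ : ∀ {a x d} c → 0ℚ < a → x ≤ c * (ofℕ 2 * a) * d → x * inv a ≤ ofℕ 2 * c * d
charge-≤ {a} {x} {d} c 0<a x≤ = begin
  x * inv a                         ≤⟨ *-monoʳ-≤-nonNeg (inv a) {{nonNegative (inv-nonneg 0<a)}} x≤ ⟩
  c * (ofℕ 2 * a) * d * inv a       ≡⟨ solve 5 (λ c t a d i → c :* (t :* a) :* d :* i := t :* c :* d :* (a :* i))
                                         refl c (ofℕ 2) a d (inv a) ⟩
  ofℕ 2 * c * d * (a * inv a)       ≡⟨ cong (ofℕ 2 * c * d *_) (inv-inverse 0<a) ⟩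
  ofℕ 2 * c * d * 1ℚ                ≡⟨ *-identityʳ (ofℕ 2 * c * d) ⟩
  ofℕ 2 * c * d                     ∎
  where
  open ≤-Reasoning
  open +-*-Solver

sumOver : ∀ {m} → Subset m → (Fin m → ℚ) → ℚ
sumOver []            h = 0ℚ
sumOver (outside ∷ S) h = sumOver S (tail h)
sumOver (inside ∷ S)  h = head h + sumOver S (tail h)

sumFin-⊤ : ∀ m (h : Fin m → ℚ) → sumFin m h ≡ sumOver ⊤ h
sumFin-⊤ zero    h = refl
sumFin-⊤ (suc m) h = cong (λ rest → head h + rest) (sumFin-⊤ m (tail h))

sumOver-empty : ∀ {m} (S : Subset m) h → Empty S → sumOver S h ≡ 0ℚ
sumOver-empty []            h _       = refl
sumOver-empty (outside ∷ S) h S-empty = sumOver-empty S (tail h) (drop-∷-Empty S-empty)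
sumOver-empty (inside ∷ S)  h S-empty = ⊥-elim (S-empty (zero , here))

sumOver-split : ∀ {m} (S F : Subset m) h → F ⊆ S →
                sumOver S h ≡ sumOver F h + sumOver (S ─ F) h
sumOver-split []      []      h _   = sym (+-identityˡ 0ℚ)
sumOver-split (s ∷ S) (f ∷ F) h F⊆S with sumOver-split S F (tail h) (drop-∷-⊆ F⊆S)
sumOver-split (outside ∷ S) (outside ∷ F) h F⊆S | split = split
sumOver-split (inside ∷ S)  (outside ∷ F) h F⊆S | split =
  trans (cong (λ rest → head h + rest) split) (x∙yz≈y∙xz (head h) (sumOver F (tail h)) (sumOver (S ─ F) (tail h)))
sumOver-split (inside ∷ S)  (inside ∷ F)  h F⊆S | split =
  trans (cong (λ rest → head h + rest) split) (sym (+-assoc (head h) _ _))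
sumOver-split (outside ∷ S) (inside ∷ F)  h F⊆S | _ with F⊆S here
... | ()

sumOver-const : ∀ {m} (F : Subset m) h x → (∀ j → j ∈ F → h j ≡ x) →
                sumOver F h ≡ ofℕ ∣ F ∣ * x
sumOver-const []            h x _    = sym (*-zeroˡ x)
sumOver-const (outside ∷ F) h x h≡x = sumOver-const F (tail h) x (λ j j∈F → h≡x (suc j) (there j∈F))
sumOver-const (inside ∷ F)  h x h≡x = begin
  head h + sumOver F (tail h)      ≡⟨ cong₂ _+_ (h≡x zero here)
                                        (sumOver-const F (tail h) x (λ j j∈F → h≡x (suc j) (there j∈F))) ⟩
  x + ofℕ ∣ F ∣ * x                ≡⟨ cong (_+ ofℕ ∣ F ∣ * x) (*-identityˡ x) ⟨
  1ℚ * x + ofℕ ∣ F ∣ * x           ≡⟨ *-distribʳ-+ x 1ℚ (ofℕ ∣ F ∣) ⟨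
  (1ℚ + ofℕ ∣ F ∣) * x             ≡⟨ cong (_* x) (ofℕ-+ 1 ∣ F ∣) ⟨
  ofℕ (suc ∣ F ∣) * x              ∎
  where open ≡-Reasoning

Fibres : ∀ {n c} → Rel (Fin n) 0ℓ → (Fin n → Fin c) → Set
Fibres R f = ∀ u v → (f u ≡ f v → R u v) × (R u v → f u ≡ f v)

Classifies : ∀ {n c} → Rel (Fin n) 0ℓ → (Fin n → Fin c) → Set
Classifies R f = Surjective _≡_ _≡_ f × Fibres R f

-- Extending a classification of R on the vertices 1..n to vertex 0: either
-- 0 joins the class of some related vertex v, or it forms a new class.
module ExtendClassification {n c} {R : Rel (Fin (suc n)) 0ℓ} (R-equiv : IsEquivalence R)
  {f : Fin n → Fin c} (f-onto : Surjective _≡_ _≡_ f)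
  (f-fibres : Fibres (λ u v → R (suc u) (suc v)) f) where

  open IsEquivalence R-equiv renaming (refl to ~-refl; sym to ~-sym; trans to ~-trans)

  joinClass : ∀ {v} → R zero (suc v) → Classifies R (f v Vector.∷ f)
  joinClass {v} 0~v = onto , fibres
    where
    onto : Surjective _≡_ _≡_ (f v Vector.∷ f)
    onto y with f-onto y
    ... | x , fx≡y = suc x , λ { refl → fx≡y refl }
    fibres : Fibres R (f v Vector.∷ f)
    fibres zero    zero    = (λ _ → ~-refl) , (λ _ → refl)
    fibres zero    (suc w) = (λ e → ~-trans 0~v (proj₁ (f-fibres v w) e))
                           , (λ r → proj₂ (f-fibres v w) (~-trans (~-sym 0~v) r))
    fibres (suc u) zero    = (λ e → ~-sym (~-trans 0~v (proj₁ (f-fibres v u) (sym e))))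
                           , (λ r → sym (proj₂ (f-fibres v u) (~-trans (~-sym 0~v) (~-sym r))))
    fibres (suc u) (suc w) = f-fibres u w

  newClass : (∀ v → ¬ R zero (suc v)) → Classifies R (zero Vector.∷ (suc ∘ f))
  newClass 0≁ = onto , fibres
    where
    onto : Surjective _≡_ _≡_ (zero Vector.∷ (suc ∘ f))
    onto zero    = zero , λ { refl → refl }
    onto (suc y) with f-onto y
    ... | x , fx≡y = suc x , λ { refl → cong suc (fx≡y refl) }
    fibres : Fibres R (zero Vector.∷ (suc ∘ f))
    fibres zero    zero    = (λ _ → ~-refl) , (λ _ → refl)
    fibres zero    (suc w) = (λ ()) , (λ r → ⊥-elim (0≁ w r))
    fibres (suc u) zero    = (λ ()) , (λ r → ⊥-elim (0≁ u (~-sym r)))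
    fibres (suc u) (suc w) = (λ e → proj₁ (f-fibres u w) (suc-injective e))
                           , (λ r → cong suc (proj₂ (f-fibres u w) r))

restrictToSuc : ∀ {n} {R : Rel (Fin (suc n)) 0ℓ} → IsDecEquivalence R →
                IsDecEquivalence (λ u v → R (suc u) (suc v))
restrictToSuc eqv = record
  { isEquivalence = record { refl = ~-refl ; sym = ~-sym ; trans = ~-trans }
  ; _≟_ = λ u v → suc u ~? suc v }
  where open IsDecEquivalence eqv renaming (refl to ~-refl; sym to ~-sym; trans to ~-trans; _≟_ to _~?_)

quotient : ∀ {n} {R : Rel (Fin n) 0ℓ} → IsDecEquivalence R → ∃ λ c → Σ (Fin n → Fin c) (Classifies R)
quotient {zero}  _   = 0 , (λ ()) , (λ ()) , (λ ())
quotient {suc n} eqv with quotient (restrictToSuc eqv) | any? (λ v → IsDecEquivalence._≟_ eqv zero (suc v))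
... | c , f , f-onto , f-fibres | yes (v , 0~v) = c , _ , joinClass 0~v
  where open ExtendClassification (IsDecEquivalence.isEquivalence eqv) f-onto f-fibres
... | c , f , f-onto , f-fibres | no 0≁ = suc c , _ , newClass (λ v 0~v → 0≁ (v , 0~v))
  where open ExtendClassification (IsDecEquivalence.isEquivalence eqv) f-onto f-fibres

module _ {n m} {E : Edges n m} {S : Subset m} where

  adjacent-sym : ∀ {u v} → Adjacent E S u v → Adjacent E S v u
  adjacent-sym (j , j∈S , u∈e , v∈e) = j , j∈S , v∈e , u∈e

  connected-isEquivalence : IsEquivalence (Connected E S)
  connected-isEquivalence = record { refl = ε ; sym = reverse adjacent-sym ; trans = _◅◅_ }

lift-connected : ∀ {n m} {E : Edges n (suc m)} {S : Subset m} b {u v} →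
                 Connected (tail E) S u v → Connected E (b ∷ S) u v
lift-connected b = gmap (λ x → x) λ { (j , j∈S , u∈e , v∈e) → suc j , there j∈S , u∈e , v∈e }

-- Connectivity when the first edge e = head E is present: u and v are
-- connected iff they are connected without e, or both are connected
-- without e to vertices of e.
module AddFirstEdge {n m} (E : Edges n (suc m)) (S : Subset m) where

  private
    C = Connected (tail E) S

  ReachesEdge : Fin n → Set
  ReachesEdge u = ∃ λ a → a ∈ head E × C a u

  ConnectedVia : Rel (Fin n) 0ℓ
  ConnectedVia u v = C u v ⊎ (ReachesEdge u × ReachesEdge v)

  open IsEquivalence (connected-isEquivalence {E = tail E} {S = S}) using () renaming (sym to C-sym)

  via-trans : ∀ {u v w} → ConnectedVia u v → ConnectedVia v w → ConnectedVia u w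
  via-trans (inj₁ u~v)                 (inj₁ v~w)                 = inj₁ (u~v ◅◅ v~w)
  via-trans (inj₁ u~v)                 (inj₂ ((a , a∈e , a~v) , rw)) = inj₂ ((a , a∈e , a~v ◅◅ C-sym u~v) , rw)
  via-trans (inj₂ (ru , (a , a∈e , a~v))) (inj₁ v~w)              = inj₂ (ru , (a , a∈e , a~v ◅◅ v~w))
  via-trans (inj₂ (ru , _))            (inj₂ (_ , rw))            = inj₂ (ru , rw)

  sound : ∀ {u v} → ConnectedVia u v → Connected E (inside ∷ S) u v
  sound (inj₁ u~v) = lift-connected inside u~v
  sound (inj₂ ((a , a∈e , a~u) , (b , b∈e , b~v))) =
    reverse adjacent-sym (lift-connected inside a~u)
      ◅◅ (zero , here , a∈e , b∈e) ◅ lift-connected inside b~v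

  complete : ∀ {u v} → Connected E (inside ∷ S) u v → ConnectedVia u v
  complete ε = inj₁ ε
  complete (edge ◅ rest) = via-trans (adjacent edge) (complete rest)
    where
    adjacent : ∀ {u v} → Adjacent E (inside ∷ S) u v → ConnectedVia u v
    adjacent {u} {v} (zero  , _          , u∈e , v∈e) = inj₂ ((u , u∈e , ε) , (v , v∈e , ε))
    adjacent         (suc j , there j∈S , u∈e , v∈e) = inj₁ ((j , j∈S , u∈e , v∈e) ◅ ε)

  via? : Decidable C → Decidable ConnectedVia
  via? C? u v = C? u v ⊎-dec (reaches? u ×-dec reaches? v)
    where
    reaches? : ∀ u → Dec (ReachesEdge u)
    reaches? u = any? (λ a → (a ∈? head E) ×-dec C? a u)

connected? : ∀ {n m} (E : Edges n m) (S : Subset m) → Decidable (Connected E S)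
connected? E []            u v = map′ (λ { refl → ε }) no-edges (u ≟ᶠ v)
  where
  no-edges : ∀ {u v} → Connected E [] u v → u ≡ v
  no-edges ε                = refl
  no-edges ((() , _) ◅ _)
connected? E (outside ∷ S) u v = map′ (lift-connected outside) (gmap (λ x → x) drop)
                                   (connected? (tail E) S u v)
  where
  drop : ∀ {u v} → Adjacent E (outside ∷ S) u v → Adjacent (tail E) S u v
  drop (suc j , there j∈S , u∈e , v∈e) = j , j∈S , u∈e , v∈e
connected? E (inside ∷ S)  u v = map′ sound complete (via? (connected? (tail E) S) u v)
  where open AddFirstEdge E S

components : ∀ {n m} (E : Edges n m) (S : Subset m) → ∃ (HasComponents E S)
components E S = quotient record { isEquivalence = connected-isEquivalence ; _≟_ = connected? E S }

components-≤ : ∀ {n m} {E : Edges n m} {S κ} → HasComponents E S κ → κ ℕ.≤ n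
components-≤ (f , f-onto , _) = injective⇒≤ section-injective
  where
  section-injective : ∀ {y y'} → proj₁ (f-onto y) ≡ proj₁ (f-onto y') → y ≡ y'
  section-injective {y} {y'} e =
    trans (sym (proj₂ (f-onto y) refl)) (trans (cong f e) (proj₂ (f-onto y') refl))

components-pos : ∀ {n m} {E : Edges (suc n) m} {S κ} → HasComponents E S κ → 1 ℕ.≤ κ
components-pos {κ = zero}  (f , _) with f zero
... | ()
components-pos {κ = suc _} _ = s≤s z≤n

module Charging {n m} (E : Edges n m) {c : ℚ} (c>0 : 0ℚ < c)
  {W : Subset m → ℚ → Subset m} (W-spec : WeakEdgesSpec E c W) {k : ℚ} (k>0 : 0ℚ < k) where

  2c≥0 : 0ℚ ≤ ofℕ 2 * c
  2c≥0 = nonNegative⁻¹ _ {{nonNeg*nonNeg⇒nonNeg (ofℕ 2) {{_}} c {{nonNegative (<⇒≤ c>0)}}}}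

  budget : ℕ → ℚ
  budget κ = ofℕ 2 * c * (ofℕ n - ofℕ κ)

  -- a real hypergraph has at most n components, so its budget is nonnegative
  budget-nonneg : ∀ {S κ} → HasComponents E S κ → 0ℚ ≤ budget κ
  budget-nonneg {κ = κ} κ-comp = begin
    0ℚ                                ≡⟨ *-zeroʳ (ofℕ 2 * c) ⟨
    ofℕ 2 * c * 0ℚ                    ≤⟨ scale-≤ 2c≥0 (ofℕ-mono-≤ {0} {n ∸ κ} z≤n) ⟩
    ofℕ 2 * c * ofℕ (n ∸ κ)           ≡⟨ cong (ofℕ 2 * c *_) (ofℕ-∸ (components-≤ κ-comp)) ⟨
    budget κ                          ∎
    where open ≤-Reasoning

  budget-drop : ∀ κ κ' → ofℕ 2 * c * (ofℕ κ' - ofℕ κ) + budget κ' ≡ budget κ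
  budget-drop κ κ' = solve 4 (λ t x y z → t :* (y :- x) :+ t :* (z :- y) := t :* (z :- x))
                       refl (ofℕ 2 * c) (ofℕ κ) (ofℕ κ') (ofℕ n)
    where open +-*-Solver

  -- round i+1 removes edges at threshold 2^(i+1) k and estimates them by 2^i k
  estimate-pos : ∀ i → 0ℚ < ofℕ (2 ^ i) * k
  estimate-pos i = positive⁻¹ _ {{pos*pos⇒pos (ofℕ (2 ^ i)) {{positive (ofℕ-pos (2 ^ i) {{ℕ.m^n≢0 2 i}})}}
                                               k {{positive k>0}}}}

  threshold≡ : ∀ i → ofℕ (2 ^ suc i) * k ≡ ofℕ 2 * (ofℕ (2 ^ i) * k)
  threshold≡ i = trans (cong (_* k) (ofℕ-* 2 (2 ^ i))) (*-assoc (ofℕ 2) (ofℕ (2 ^ i)) k)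

  cost-≤-budget : ∀ {i S γ'} → EstimationFrom E W k (suc i) S γ' →
                  ∀ {κ} → HasComponents E S κ → sumOver S (inv ∘ γ') ≤ budget κ
  cost-≤-budget {S = S} {γ'} (stop S-empty) {κ} κ-comp = begin
    sumOver S (inv ∘ γ')   ≡⟨ sumOver-empty S (inv ∘ γ') S-empty ⟩
    0ℚ                     ≤⟨ budget-nonneg κ-comp ⟩
    budget κ               ∎
    where open ≤-Reasoning
  cost-≤-budget {i} {S} {γ'} (step _ γ'-on-F rest) {κ} κ-comp = begin
    sumOver S (inv ∘ γ')                                   ≡⟨ sumOver-split S F (inv ∘ γ') F⊆S ⟩
    sumOver F (inv ∘ γ') + sumOver (S ─ F) (inv ∘ γ')      ≤⟨ +-mono-≤ removed-cost (cost-≤-budget rest κ'-comp) ⟩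
    ofℕ 2 * c * (ofℕ κ' - ofℕ κ) + budget κ'               ≡⟨ budget-drop κ κ' ⟩
    budget κ                                               ∎
    where
    open ≤-Reasoning
    K : ℚ
    K = ofℕ (2 ^ suc i) * k
    F : Subset m
    F = W S K
    F⊆S : F ⊆ S
    F⊆S = proj₁ (W-spec S K)
    κ' : ℕ
    κ' = proj₁ (components E (S ─ F))
    κ'-comp : HasComponents E (S ─ F) κ'
    κ'-comp = proj₂ (components E (S ─ F))
    removed-cost : sumOver F (inv ∘ γ') ≤ ofℕ 2 * c * (ofℕ κ' - ofℕ κ)
    removed-cost = begin
      sumOver F (inv ∘ γ')                ≡⟨ sumOver-const F (inv ∘ γ') (inv (ofℕ (2 ^ i) * k))
                                               (λ j j∈F → cong inv (γ'-on-F j (F⊆S j∈F) j∈F)) ⟩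
      ofℕ ∣ F ∣ * inv (ofℕ (2 ^ i) * k)   ≤⟨ charge-≤ c (estimate-pos i) light ⟩
      ofℕ 2 * c * (ofℕ κ' - ofℕ κ)        ∎
      where
      light : ofℕ ∣ F ∣ ≤ c * (ofℕ 2 * (ofℕ (2 ^ i) * k)) * (ofℕ κ' - ofℕ κ)
      light = subst (λ K → ofℕ ∣ F ∣ ≤ c * K * (ofℕ κ' - ofℕ κ)) (threshold≡ i)
                (proj₂ (proj₂ (W-spec S K)) κ κ' κ-comp κ'-comp)

-- Lemma 12: apply the invariant to H_0 = H and use κ(H) ≥ 1.
lemma12 : ∀ (n m : ℕ) → n ≥ 1 → (E : Edges n m) → (∀ j → Nonempty (E j)) →
    (c : ℚ) → 0ℚ < c →
    (W : Subset m → ℚ → Subset m) → WeakEdgesSpec E c W →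
    (k : ℚ) → 0ℚ < k → (∀ j → StrengthAtLeast E ⊤ j k) →
    (γ' : Fin m → ℚ) → Estimation E W k γ' →
    sumFin m (λ j → inv (γ' j)) ≤ ofℕ 2 * c * ofℕ (n ∸ 1)
lemma12 (suc n) m _ E _ c c>0 W W-spec k k>0 _ γ' run = begin
  sumFin m (inv ∘ γ')                 ≡⟨ sumFin-⊤ m (inv ∘ γ') ⟩
  sumOver ⊤ (inv ∘ γ')                ≤⟨ cost-≤-budget run κ-comp ⟩
  ofℕ 2 * c * (ofℕ (suc n) - ofℕ κ)   ≡⟨ cong (ofℕ 2 * c *_) (ofℕ-∸ (components-≤ κ-comp)) ⟩
  ofℕ 2 * c * ofℕ (suc n ∸ κ)         ≤⟨ scale-≤ 2c≥0 (ofℕ-mono-≤ (ℕ.∸-monoʳ-≤ (suc n) (components-pos κ-comp))) ⟩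
  ofℕ 2 * c * ofℕ (suc n ∸ 1)         ∎
  where
  open ≤-Reasoning
  open Charging E c>0 W-spec k>0
  κ : ℕ
  κ = proj₁ (components E ⊤)
  κ-comp : HasComponents E ⊤ κ
  κ-comp = proj₂ (components E ⊤)
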